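{- Let $\Gamma$ be an Euler graph with adjacency matrix $A$. Then $\mathbf 1^\top A\mathbf 1\equiv 0 \pmod 2$ and $\mathbf 1^\top A^i\mathbf 1\equiv 0\pmod 4$ for all integers $i\geqslant 2$.
   Context: An Euler graph is a (simple) graph in which every vertex has even degree. $\mathbf 1$ denotes the all-ones vector. -}

module Defs where

open import Data.Nat using (ℕ; zero; suc; _+_; _*_)
open import Data.Fin using (Fin; zero; suc)
open import Data.Bool using (Bool; true; false)
open import Relation.Binary.PropositionalEquality using (_≡_)
open import Data.Product using (_×_)
open import Data.Nat.Divisibility using (_∣_)

sumFin : (n : ℕ) → (Fin n → ℕ) → ℕ
sumFin zero    f = 0
sumFin (suc n) f = f zero + sumFin n (λ i → f (suc i))

Matrix : ℕ → Set
Matrix n = Fin n → Fin n → ℕ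

_·_ : {n : ℕ} → Matrix n → Matrix n → Matrix n
_·_ {n} A B i j = sumFin n (λ k → A i k * B k j)

identity : (n : ℕ) → Matrix n
identity n = δ
  where
  δ : {m : ℕ} → Fin m → Fin m → ℕ
  δ zero    zero    = 1
  δ zero    (suc _) = 0
  δ (suc _) zero    = 0
  δ (suc i) (suc j) = δ i j

_^ᴹ_ : {n : ℕ} → Matrix n → ℕ → Matrix n
_^ᴹ_ {n} A zero    = identity n
_^ᴹ_ {n} A (suc i) = A · (A ^ᴹ i)

onesForm : {n : ℕ} → Matrix n → ℕ
onesForm {n} M = sumFin n (λ i → sumFin n (λ j → M i j))

record SimpleGraph (n : ℕ) : Set where
  field
    Adj     : Fin n → Fin n → Bool
    symm    : ∀ i j → Adj i j ≡ Adj j i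
    irrefl  : ∀ i → Adj i i ≡ false

open SimpleGraph public

bool→ℕ : Bool → ℕ
bool→ℕ true  = 1
bool→ℕ false = 0

adjacencyMatrix : {n : ℕ} → SimpleGraph n → Matrix n
adjacencyMatrix G i j = bool→ℕ (Adj G i j)

degree : {n : ℕ} → SimpleGraph n → Fin n → ℕ
degree {n} G v = sumFin n (λ w → bool→ℕ (Adj G v w))

IsEuler : {n : ℕ} → SimpleGraph n → Set
IsEuler G = ∀ v → 2 ∣ degree G v

{-# OPTIONS --safe #-}
module Submission where

open import Defs
open import Data.Nat using (ℕ; _≤_; zero; suc; _+_; _*_; s≤s)
open import Data.Nat.Properties using (*-comm; *-zeroʳ; *-identityʳ; *-distribˡ-+; +-commutativeSemigroup)
open import Data.Nat.Divisibility using (_∣_; _∣0; ∣m∣n⇒∣m+n; ∣n⇒∣m*n; *-pres-∣)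
open import Data.Product using (_×_; _,_)
open import Data.Fin using (Fin; zero; suc)
open import Relation.Binary.PropositionalEquality using (_≡_; refl; sym; trans; cong; cong₂; subst; module ≡-Reasoning)
open import Algebra.Properties.CommutativeSemigroup +-commutativeSemigroup using (interchange)
open ≡-Reasoning

-- 1ᵀ A 1 is the sum of the degrees. Write r_k = A^k 1; then r_{k+1} = A r_k, so every
-- r_{k+1} is even because r_1 is the degree vector. By symmetry of A,
-- 1ᵀ A^{k+1} 1 = (A 1)ᵀ r_k = Σ_v deg v · r_k(v), and for k ≥ 1 every summand is a
-- product of two even numbers.

sumFin-cong : ∀ n {f g : Fin n → ℕ} → (∀ i → f i ≡ g i) → sumFin n f ≡ sumFin n g
sumFin-cong zero    f≗g = refl
sumFin-cong (suc n) f≗g = cong₂ _+_ (f≗g zero) (sumFin-cong n (λ i → f≗g (suc i)))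

sumFin-+ : ∀ n (f g : Fin n → ℕ) →
  sumFin n (λ i → f i + g i) ≡ sumFin n f + sumFin n g
sumFin-+ zero    f g = refl
sumFin-+ (suc n) f g = begin
  (f zero + g zero) + sumFin n (λ i → f (suc i) + g (suc i))
    ≡⟨ cong ((f zero + g zero) +_) (sumFin-+ n (λ i → f (suc i)) (λ i → g (suc i))) ⟩
  (f zero + g zero) + (sumFin n (λ i → f (suc i)) + sumFin n (λ i → g (suc i)))
    ≡⟨ interchange (f zero) (g zero) _ _ ⟩
  (f zero + sumFin n (λ i → f (suc i))) + (g zero + sumFin n (λ i → g (suc i))) ∎

sumFin-0 : ∀ n → sumFin n (λ _ → 0) ≡ 0
sumFin-0 zero    = refl
sumFin-0 (suc n) = sumFin-0 n

sumFin-*ˡ : ∀ n c (f : Fin n → ℕ) → sumFin n (λ i → c * f i) ≡ c * sumFin n f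
sumFin-*ˡ zero    c f = sym (*-zeroʳ c)
sumFin-*ˡ (suc n) c f = trans (cong (c * f zero +_) (sumFin-*ˡ n c (λ i → f (suc i))))
                              (sym (*-distribˡ-+ c (f zero) _))

sumFin-*ʳ : ∀ n c (f : Fin n → ℕ) → sumFin n (λ i → f i * c) ≡ sumFin n f * c
sumFin-*ʳ n c f = begin
  sumFin n (λ i → f i * c) ≡⟨ sumFin-cong n (λ i → *-comm (f i) c) ⟩
  sumFin n (λ i → c * f i) ≡⟨ sumFin-*ˡ n c f ⟩
  c * sumFin n f           ≡⟨ *-comm c _ ⟩
  sumFin n f * c           ∎

sumFin-swap : ∀ n m (f : Fin n → Fin m → ℕ) →
  sumFin n (λ i → sumFin m (f i)) ≡ sumFin m (λ j → sumFin n (λ i → f i j))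
sumFin-swap zero    m f = sym (sumFin-0 m)
sumFin-swap (suc n) m f = begin
  sumFin m (f zero) + sumFin n (λ i → sumFin m (f (suc i)))
    ≡⟨ cong (sumFin m (f zero) +_) (sumFin-swap n m (λ i → f (suc i))) ⟩
  sumFin m (f zero) + sumFin m (λ j → sumFin n (λ i → f (suc i) j))
    ≡⟨ sym (sumFin-+ m (f zero) _) ⟩
  sumFin m (λ j → f zero j + sumFin n (λ i → f (suc i) j)) ∎

∣-sumFin : ∀ n {d} {f : Fin n → ℕ} → (∀ i → d ∣ f i) → d ∣ sumFin n f
∣-sumFin zero    d∣f = _ ∣0
∣-sumFin (suc n) d∣f = ∣m∣n⇒∣m+n (d∣f zero) (∣-sumFin n (λ i → d∣f (suc i)))

rowSum : {n : ℕ} → Matrix n → Fin n → ℕ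
rowSum {n} M i = sumFin n (M i)

columnSum : {n : ℕ} → Matrix n → Fin n → ℕ
columnSum {n} M j = sumFin n (λ i → M i j)

rowSum-identity : ∀ n (i : Fin n) → rowSum (identity n) i ≡ 1
rowSum-identity (suc n) zero    = cong suc (sumFin-0 n)
rowSum-identity (suc n) (suc i) = rowSum-identity n i

rowSum-· : ∀ {n} (A B : Matrix n) i → rowSum (A · B) i ≡ sumFin n (λ l → A i l * rowSum B l)
rowSum-· {n} A B i = begin
  sumFin n (λ j → sumFin n (λ l → A i l * B l j))
    ≡⟨ sumFin-swap n n _ ⟩
  sumFin n (λ l → sumFin n (λ j → A i l * B l j))
    ≡⟨ sumFin-cong n (λ l → sumFin-*ˡ n (A i l) (B l)) ⟩
  sumFin n (λ l → A i l * rowSum B l) ∎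

onesForm-· : ∀ {n} (A B : Matrix n) →
  onesForm (A · B) ≡ sumFin n (λ l → columnSum A l * rowSum B l)
onesForm-· {n} A B = begin
  sumFin n (rowSum (A · B))
    ≡⟨ sumFin-cong n (rowSum-· A B) ⟩
  sumFin n (λ i → sumFin n (λ l → A i l * rowSum B l))
    ≡⟨ sumFin-swap n n _ ⟩
  sumFin n (λ l → sumFin n (λ i → A i l * rowSum B l))
    ≡⟨ sumFin-cong n (λ l → sumFin-*ʳ n (rowSum B l) (λ i → A i l)) ⟩
  sumFin n (λ l → columnSum A l * rowSum B l) ∎

∣-rowSum-·ˡ : ∀ {n d} (A B : Matrix n) → (∀ l → d ∣ rowSum B l) → ∀ i → d ∣ rowSum (A · B) i
∣-rowSum-·ˡ {n} A B d∣rowSum i =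
  subst (_ ∣_) (sym (rowSum-· A B i)) (∣-sumFin n (λ l → ∣n⇒∣m*n (A i l) (d∣rowSum l)))

∣-rowSum-^ᴹ : ∀ {n d} (A : Matrix n) → (∀ i → d ∣ rowSum A i) →
  ∀ k i → d ∣ rowSum (A ^ᴹ suc k) i
∣-rowSum-^ᴹ {n} A d∣rowSum zero i = subst (_ ∣_) (sym rowSum-A·I) (d∣rowSum i)
  where
  rowSum-A·I : rowSum (A · identity n) i ≡ rowSum A i
  rowSum-A·I = trans (rowSum-· A (identity n) i)
    (sumFin-cong n (λ l → trans (cong (A i l *_) (rowSum-identity n l)) (*-identityʳ (A i l))))
∣-rowSum-^ᴹ A d∣rowSum (suc k) = ∣-rowSum-·ˡ A _ (∣-rowSum-^ᴹ A d∣rowSum k)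

columnSum-adjacencyMatrix : ∀ {n} (G : SimpleGraph n) l →
  columnSum (adjacencyMatrix G) l ≡ degree G l
columnSum-adjacencyMatrix {n} G l = sumFin-cong n (λ i → cong bool→ℕ (symm G i l))

lemma2p6 : (n : ℕ) (G : SimpleGraph n) → IsEuler G →
    (2 ∣ onesForm (adjacencyMatrix G))
    × (∀ (i : ℕ) → 2 ≤ i → 4 ∣ onesForm (adjacencyMatrix G ^ᴹ i))
lemma2p6 n G euler = ∣-sumFin n euler , λ { (suc (suc k)) (s≤s (s≤s _)) → 4∣onesForm k }
  where
  A : Matrix n
  A = adjacencyMatrix G

  4∣onesForm : ∀ k → 4 ∣ onesForm (A · (A ^ᴹ suc k))
  4∣onesForm k = subst (4 ∣_) (sym (onesForm-· A (A ^ᴹ suc k)))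
    (∣-sumFin n (λ l → subst (λ c → 4 ∣ c * rowSum (A ^ᴹ suc k) l)
                             (sym (columnSum-adjacencyMatrix G l))
                             (*-pres-∣ (euler l) (∣-rowSum-^ᴹ A euler k l))))
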